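{- Let $n \ge 1$ be an integer and $p \in [0,1]$. Let $G$ be a directed graph on $n$ vertices, initially with no edges, generated randomly as follows: independently for each vertex $v$ of $G$, choose a vertex $w$ uniformly at random from all $n$ vertices of $G$ (possibly $w = v$), and with probability $p$ (independently of everything else) call $v$ good and add a directed edge from $v$ to $w$; if $v$ is not good, no edge is added from $v$. Then the probability that $G$ contains a directed cycle (where a self-loop, i.e. an edge from a vertex to itself, counts as a directed cycle) is exactly $p$.
   Context: In the resulting random directed graph every vertex has out-degree at most $1$, and a vertex has out-degree $1$ exactly when it is good.
   Formalization: The probability p ranges only over the rational numbers in the interval [0,1]. -}

module Defs where

open import Data.Nat using (ℕ; zero; suc)
open import Data.Fin using (Fin)
open import Data.Bool using (Bool; true; false; if_then_else_)
open import Data.Product using (Σ; _×_; _,_; proj₁; proj₂)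
open import Data.Integer using (+_)
open import Data.Rational using (ℚ; _+_; _*_; _-_; _/_; 0ℚ; 1ℚ)
open import Data.Vec.Functional using (_∷_)
open import Relation.Binary.PropositionalEquality using (_≡_)
open import Relation.Nullary using (Dec; yes; no)
open import Relation.Unary using (Decidable)

sumFin : (k : ℕ) → (Fin k → ℚ) → ℚ
sumFin zero    f = 0ℚ
sumFin (suc k) f = f Fin.zero + sumFin k (λ i → f (Fin.suc i))

prodFin : (k : ℕ) → (Fin k → ℚ) → ℚ
prodFin zero    f = 1ℚ
prodFin (suc k) f = f Fin.zero * prodFin k (λ i → f (Fin.suc i))

sumFuns : {A : Set} → ((A → ℚ) → ℚ) → (k : ℕ) → ((Fin k → A) → ℚ) → ℚ
sumFuns SA zero    f = f (λ ())
sumFuns SA (suc k) f = SA (λ a → sumFuns SA k (λ g → f (a ∷ g)))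

-- per-vertex random data: chosen target w, and whether the vertex is good
VertexData : ℕ → Set
VertexData n = Fin n × Bool

sumVertexData : (n : ℕ) → (VertexData n → ℚ) → ℚ
sumVertexData n f = sumFin n (λ w → f (w , true) + f (w , false))

Outcome : ℕ → Set
Outcome n = Fin n → VertexData n

Edge : {n : ℕ} → Outcome n → Fin n → Fin n → Set
Edge o v w = (proj₂ (o v) ≡ true) × (proj₁ (o v) ≡ w)

data Walk {n : ℕ} (o : Outcome n) : ℕ → Fin n → Fin n → Set where
  here : ∀ {v} → Walk o zero v v
  step : ∀ {k u v w} → Edge o u v → Walk o k v w → Walk o (suc k) u w

HasCycle : {n : ℕ} → Outcome n → Set
HasCycle {n} o = Σ (Fin n) λ v → Σ ℕ λ k → Walk o (suc k) v v

vertexWeight : (m : ℕ) → ℚ → VertexData (suc m) → ℚ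
vertexWeight m p (w , b) = (+ 1 / suc m) * (if b then p else (1ℚ - p))

outcomeWeight : (m : ℕ) → ℚ → Outcome (suc m) → ℚ
outcomeWeight m p o = prodFin (suc m) (λ v → vertexWeight m p (o v))

Pr : (m : ℕ) → ℚ → {E : Outcome (suc m) → Set} → Decidable E → ℚ
Pr m p E? = sumFuns (sumVertexData (suc m)) (suc m)
  (λ o → indicator (E? o) (outcomeWeight m p o))
  where
  indicator : ∀ {P : Set} → Dec P → ℚ → ℚ
  indicator (yes _) x = x
  indicator (no _)  _ = 0ℚ

{-# OPTIONS --safe #-}

-- Explore the outcome one vertex at a time.  At every stage each vertex x has an exit: following
-- edges from x through explored vertices, one either reaches an unexplored vertex or gets stuck
-- at a bad vertex.  Exploring the current vertex c either closes a cycle (c is good and its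
-- target exits at c) or hands c's own exit to every vertex exiting at c.  The quantity
-- p · (fraction of vertices exiting at an unexplored vertex) is a martingale of this process: it
-- starts at p, and once every vertex is explored it is 1 if a cycle was closed and 0 otherwise.

module Submission where

open import Defs
open import Algebra.Bundles using (CommutativeRing)
open import Data.Bool using (Bool; true; false; if_then_else_)
open import Data.Fin using (Fin; zero; suc)
open import Data.Integer as ℤ using (+_; 1ℤ)
open import Data.Maybe using (Maybe; just; nothing; is-just)
open import Data.Nat using (ℕ; zero; suc)
import Data.Nat.Coprimality as Coprimality
open import Data.Product using (_,_; proj₁; proj₂; ∃-syntax)
open import Data.Rational using (ℚ; 0ℚ; 1ℚ; _+_; _*_; _-_; _/_; _≤_)
open import Data.Rational.Literals using (fromℤ)
open import Data.Rational.Properties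
  using (_≟_; +-*-commutativeRing; toℚᵘ-injective; toℚᵘ-homo-+; normalize-coprime;
         *-inverseˡ; *-assoc; *-identityˡ; *-identityʳ; *-zeroˡ; *-zeroʳ; *-distribˡ-+)
open import Data.Rational.Unnormalised using (*≡*)
open import Data.Rational.Unnormalised.Properties using (≃-trans)
open import Data.Vec.Functional using (_∷_; head; tail)
open import Level using (0ℓ)
open import Relation.Binary.PropositionalEquality using (_≡_; refl; sym; trans; cong; cong₂; module ≡-Reasoning)
open import Relation.Nullary using (does; proof; yes; no; ¬_)
open import Relation.Nullary.Decidable using (dec⇒maybe)
open import Relation.Nullary.Reflects using (Reflects; ofʸ; ofⁿ; det)
open import Relation.Unary using (Decidable)
open import Tactic.RingSolver using (solve-∀)
open import Tactic.RingSolver.Core.AlmostCommutativeRing using (AlmostCommutativeRing; fromCommutativeRing)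
open import Algebra.Properties.Semiring.Sum (CommutativeRing.semiring +-*-commutativeRing)
  using (sum-syntax; sum-cong-≗; ∑-distrib-+; *-distribˡ-sum; *-distribʳ-sum)
open import Data.Integer.Tactic.RingSolver using () renaming (solve-∀ to ℤ-solve-∀)
open ≡-Reasoning

ℚ-ring : AlmostCommutativeRing 0ℓ 0ℓ
ℚ-ring = fromCommutativeRing +-*-commutativeRing (λ x → dec⇒maybe (0ℚ ≟ x))

fromℤ-suc : ∀ k → 1ℚ + fromℤ (+ k) ≡ fromℤ (+ suc k)
fromℤ-suc k = toℚᵘ-injective (≃-trans (toℚᵘ-homo-+ 1ℚ (fromℤ (+ k))) (*≡* (cross (+ k))))
  where
  cross : ∀ x → (1ℤ ℤ.* 1ℤ ℤ.+ x ℤ.* 1ℤ) ℤ.* 1ℤ ≡ (1ℤ ℤ.+ x) ℤ.* (1ℤ ℤ.* 1ℤ)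
  cross = ℤ-solve-∀

∑-const : ∀ k c → ∑[ i < k ] c ≡ fromℤ (+ k) * c
∑-const zero c = sym (*-zeroˡ c)
∑-const (suc k) c = begin
  c + ∑[ i < k ] c          ≡⟨ cong (_+_ c) (∑-const k c) ⟩
  c + fromℤ (+ k) * c       ≡⟨ factor c (fromℤ (+ k)) ⟩
  (1ℚ + fromℤ (+ k)) * c    ≡⟨ cong (_* c) (fromℤ-suc k) ⟩
  fromℤ (+ suc k) * c       ∎
  where
  factor : ∀ c x → c + x * c ≡ (1ℚ + x) * c
  factor = solve-∀ ℚ-ring

1/n*n≡1 : ∀ m → (+ 1 / suc m) * fromℤ (+ suc m) ≡ 1ℚ
1/n*n≡1 m = trans (cong (_* fromℤ (+ suc m)) (normalize-coprime (Coprimality.1-coprimeTo (suc m))))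
                  (*-inverseˡ (fromℤ (+ suc m)))

sumFin≡∑ : ∀ k (f : Fin k → ℚ) → sumFin k f ≡ ∑[ i < k ] f i
sumFin≡∑ zero f = refl
sumFin≡∑ (suc k) f = cong (_+_ (f zero)) (sumFin≡∑ k (tail f))

module _ (n : ℕ) where

  sumVertexData≡∑ : ∀ f → sumVertexData n f ≡ ∑[ w < n ] (f (w , true) + f (w , false))
  sumVertexData≡∑ f = sumFin≡∑ n _

  sumVertexData-cong : ∀ {f g} → (∀ a → f a ≡ g a) → sumVertexData n f ≡ sumVertexData n g
  sumVertexData-cong {f} {g} f≗g = begin
    sumVertexData n f
      ≡⟨ sumVertexData≡∑ f ⟩
    ∑[ w < n ] (f (w , true) + f (w , false))
      ≡⟨ sum-cong-≗ (λ w → cong₂ _+_ (f≗g (w , true)) (f≗g (w , false))) ⟩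
    ∑[ w < n ] (g (w , true) + g (w , false))
      ≡⟨ sumVertexData≡∑ g ⟨
    sumVertexData n g
      ∎

  sumVertexData-*ˡ : ∀ c f → sumVertexData n (λ a → c * f a) ≡ c * sumVertexData n f
  sumVertexData-*ˡ c f = begin
    sumVertexData n (λ a → c * f a)
      ≡⟨ sumVertexData≡∑ (λ a → c * f a) ⟩
    ∑[ w < n ] (c * f (w , true) + c * f (w , false))
      ≡⟨ sum-cong-≗ (λ w → *-distribˡ-+ c (f (w , true)) (f (w , false))) ⟨
    ∑[ w < n ] (c * (f (w , true) + f (w , false)))
      ≡⟨ *-distribˡ-sum c (λ w → f (w , true) + f (w , false)) ⟨
    c * ∑[ w < n ] (f (w , true) + f (w , false))
      ≡⟨ cong (c *_) (sumVertexData≡∑ f) ⟨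
    c * sumVertexData n f
      ∎

run : ∀ {A : Set} {S : ℕ → Set} → (∀ k → S (suc k) → A → S k) → ∀ k → S k → (Fin k → A) → S 0
run next zero    s g = s
run next (suc k) s g = run next k (next k s (head g)) (tail g)

module Expectation {A : Set} (Σ : (A → ℚ) → ℚ)
  (Σ-cong : ∀ {f g} → (∀ a → f a ≡ g a) → Σ f ≡ Σ g)
  (Σ-*ˡ : ∀ c f → Σ (λ a → c * f a) ≡ c * Σ f) where

  sumFuns-cong : ∀ k {F G : (Fin k → A) → ℚ} → (∀ g → F g ≡ G g) → sumFuns Σ k F ≡ sumFuns Σ k G
  sumFuns-cong zero F≗G = F≗G _
  sumFuns-cong (suc k) F≗G = Σ-cong (λ a → sumFuns-cong k (λ g → F≗G (a ∷ g)))

  sumFuns-*ˡ : ∀ k c (F : (Fin k → A) → ℚ) → sumFuns Σ k (λ g → c * F g) ≡ c * sumFuns Σ k F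
  sumFuns-*ˡ zero c F = refl
  sumFuns-*ˡ (suc k) c F = trans (Σ-cong (λ a → sumFuns-*ˡ k c (λ g → F (a ∷ g)))) (Σ-*ˡ c _)

  module _ (w : A → ℚ) where

    𝔼 : (k : ℕ) → ((Fin k → A) → ℚ) → ℚ
    𝔼 k X = sumFuns Σ k (λ g → X g * prodFin k (λ i → w (g i)))

    𝔼-cong : ∀ k {X Y : (Fin k → A) → ℚ} → (∀ g → X g ≡ Y g) → 𝔼 k X ≡ 𝔼 k Y
    𝔼-cong k X≗Y = sumFuns-cong k (λ g → cong (_* _) (X≗Y g))

    𝔼-suc : ∀ k (X : (Fin (suc k) → A) → ℚ) → 𝔼 (suc k) X ≡ Σ (λ a → w a * 𝔼 k (λ g → X (a ∷ g)))
    𝔼-suc k X = Σ-cong (λ a → trans (sumFuns-cong k (λ g → swap (X (a ∷ g)) (w a) _)) (sumFuns-*ˡ k (w a) _))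
      where
      swap : ∀ x y z → x * (y * z) ≡ y * (x * z)
      swap = solve-∀ ℚ-ring

    𝔼-value-run : ∀ {S : ℕ → Set} (next : ∀ k → S (suc k) → A → S k) (value : ∀ k → S k → ℚ) →
                  (∀ k (s : S (suc k)) → Σ (λ a → w a * value k (next k s a)) ≡ value (suc k) s) →
                  ∀ k (s : S k) → 𝔼 k (λ g → value 0 (run next k s g)) ≡ value k s
    𝔼-value-run next value martingale zero s = *-identityʳ (value 0 s)
    𝔼-value-run next value martingale (suc k) s = begin
      𝔼 (suc k) (λ g → value 0 (run next (suc k) s g))
        ≡⟨ 𝔼-suc k (λ g → value 0 (run next (suc k) s g)) ⟩
      Σ (λ a → w a * 𝔼 k (λ g → value 0 (run next k (next k s a) g)))
        ≡⟨ Σ-cong (λ a → cong (w a *_) (𝔼-value-run next value martingale k (next k s a))) ⟩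
      Σ (λ a → w a * value k (next k s a))
        ≡⟨ martingale k s ⟩
      value (suc k) s
        ∎

𝟙 : Bool → ℚ
𝟙 true  = 1ℚ
𝟙 false = 0ℚ

retarget : ∀ {k} → Maybe (Fin k) → Maybe (Fin (suc k)) → Maybe (Fin k)
retarget r nothing        = nothing
retarget r (just zero)    = r
retarget r (just (suc j)) = just j

toCurrent : ∀ {k} → Maybe (Fin (suc k)) → ℚ
toCurrent (just zero) = 1ℚ
toCurrent _           = 0ℚ

toLater : ∀ {k} → Maybe (Fin (suc k)) → ℚ
toLater (just (suc _)) = 1ℚ
toLater _              = 0ℚ

𝟙-is-just-split : ∀ {k} (r : Maybe (Fin (suc k))) → 𝟙 (is-just r) ≡ toCurrent r + toLater r
𝟙-is-just-split nothing        = refl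
𝟙-is-just-split (just zero)    = refl
𝟙-is-just-split (just (suc _)) = refl

𝟙-is-just-retarget-nothing : ∀ {k} (r : Maybe (Fin (suc k))) → 𝟙 (is-just (retarget nothing r)) ≡ toLater r
𝟙-is-just-retarget-nothing nothing        = refl
𝟙-is-just-retarget-nothing (just zero)    = refl
𝟙-is-just-retarget-nothing (just (suc _)) = refl

𝟙-is-just-retarget-just : ∀ {k} j (r : Maybe (Fin (suc k))) → 𝟙 (is-just (retarget (just j) r)) ≡ 𝟙 (is-just r)
𝟙-is-just-retarget-just j nothing        = refl
𝟙-is-just-retarget-just j (just zero)    = refl
𝟙-is-just-retarget-just j (just (suc _)) = refl

module Exploration (n : ℕ) where

  -- The k unexplored vertices are numbered by Fin k in the order they will be visited; in
  -- exploring φ, φ x = just j means that x exits at the j-th of them, nothing that x gets stuck.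
  data State (k : ℕ) : Set where
    cycle     : State k
    exploring : (Fin n → Maybe (Fin k)) → State k

  settle : ∀ {k} → (Fin n → Maybe (Fin (suc k))) → Maybe (Fin (suc k)) → State k
  settle φ nothing        = exploring (λ x → retarget nothing (φ x))
  settle φ (just zero)    = cycle
  settle φ (just (suc j)) = exploring (λ x → retarget (just j) (φ x))

  visit : ∀ k → State (suc k) → VertexData n → State k
  visit k cycle         _       = cycle
  visit k (exploring φ) (w , b) = settle φ (if b then φ w else nothing)

  start : State n
  start = exploring just

  isCycle : ∀ {k} → State k → Bool
  isCycle cycle         = true
  isCycle (exploring _) = false

  module _ (o : Outcome n) where

    -- The path of an exit may pass through unexplored vertices; only its finiteness is used.
    data Exit {k} (unexplored : Fin k → Fin n) : Fin n → Maybe (Fin k) → Set where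
      arrive  : ∀ j → Exit unexplored (unexplored j) (just j)
      stop    : ∀ {x} → proj₂ (o x) ≡ false → Exit unexplored x nothing
      proceed : ∀ {x y r} → Edge o x y → Exit unexplored y r → Exit unexplored x r

    _∷ʳ_ : ∀ {l x y z} → Walk o l x y → Edge o y z → Walk o (suc l) x z
    here       ∷ʳ e = step e here
    (step d w) ∷ʳ e = step d (w ∷ʳ e)

    exit⇒walk : ∀ {k} {unexplored : Fin k → Fin n} {x j} →
                Exit unexplored x (just j) → ∃[ l ] Walk o l x (unexplored j)
    exit⇒walk (arrive j)       = 0 , here
    exit⇒walk (proceed e exit) = let l , walk = exit⇒walk exit in suc l , step e walk

    on-cycle⇒exit-just : ∀ {k} {unexplored : Fin k → Fin n} {x r l} →
                         Exit unexplored x r → Walk o (suc l) x x → ∃[ j ] r ≡ just j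
    on-cycle⇒exit-just (arrive j)                  _                   = j , refl
    on-cycle⇒exit-just (stop bad)                  (step (good , _) _) with () ← trans (sym bad) good
    on-cycle⇒exit-just (proceed e@(_ , refl) exit) (step (_ , refl) w) = on-cycle⇒exit-just exit (w ∷ʳ e)

    exit-retarget : ∀ {k} {unexplored : Fin (suc k) → Fin n} {x r r₀} →
                    Exit unexplored x r → (r ≡ just zero → Exit (tail unexplored) (head unexplored) r₀) →
                    Exit (tail unexplored) x (retarget r₀ r)
    exit-retarget (arrive zero)    exit₀ = exit₀ refl
    exit-retarget (arrive (suc j)) exit₀ = arrive j
    exit-retarget (stop bad)       exit₀ = stop bad
    exit-retarget (proceed e exit) exit₀ = proceed e (exit-retarget exit exit₀)

    Invariant : ∀ {k} → (Fin k → Fin n) → State k → Set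
    Invariant unexplored cycle         = HasCycle o
    Invariant unexplored (exploring φ) = ∀ x → Exit unexplored x (φ x)

    retarget-invariant : ∀ {k} {unexplored : Fin (suc k) → Fin n} {φ : Fin n → Maybe (Fin (suc k))} {r₀} →
                         (∀ x → Exit unexplored x (φ x)) → Exit (tail unexplored) (head unexplored) r₀ →
                         ∀ x → Exit (tail unexplored) x (retarget r₀ (φ x))
    retarget-invariant exits exit₀ x = exit-retarget (exits x) (λ _ → exit₀)

    invariant-settle : ∀ {k} {unexplored : Fin (suc k) → Fin n} {φ : Fin n → Maybe (Fin (suc k))} {w} →
                       (∀ x → Exit unexplored x (φ x)) → Edge o (head unexplored) w →
                       Invariant (tail unexplored) (settle φ (φ w))
    invariant-settle {unexplored = unexplored} {φ} {w} exits edge with φ w | exits w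
    ... | nothing      | exit = retarget-invariant exits (proceed edge (exit-retarget {r₀ = nothing} exit λ ()))
    ... | just (suc j) | exit = retarget-invariant exits (proceed edge (exit-retarget {r₀ = nothing} exit λ ()))
    ... | just zero    | exit = let l , walk = exit⇒walk exit in head unexplored , l , step edge walk

    invariant-visit : ∀ {k} (unexplored : Fin (suc k) → Fin n) (s : State (suc k)) →
                      Invariant unexplored s → Invariant (tail unexplored) (visit k s (o (head unexplored)))
    invariant-visit unexplored cycle         hasCycle = hasCycle
    invariant-visit unexplored (exploring φ) exits with o (head unexplored) in eq
    ... | w , false = retarget-invariant exits (stop (cong proj₂ eq))
    ... | w , true  = invariant-settle exits (cong proj₂ eq , cong proj₁ eq)

    final-reflects : ∀ {unexplored : Fin 0 → Fin n} (s : State 0) →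
                     Invariant unexplored s → Reflects (HasCycle o) (isCycle s)
    final-reflects cycle         hasCycle = ofʸ hasCycle
    final-reflects (exploring φ) exits    = ofⁿ acyclic
      where
      acyclic : ¬ HasCycle o
      acyclic (x , l , walk) with () ← proj₁ (on-cycle⇒exit-just (exits x) walk)

    run-reflects : ∀ k (unexplored : Fin k → Fin n) (s : State k) → Invariant unexplored s →
                   Reflects (HasCycle o) (isCycle (run visit k s (λ i → o (unexplored i))))
    run-reflects zero    unexplored s inv = final-reflects s inv
    run-reflects (suc k) unexplored s inv =
      run-reflects k (tail unexplored) (visit k s (o (head unexplored))) (invariant-visit unexplored s inv)

    start-reflects : Reflects (HasCycle o) (isCycle (run visit n start o))
    start-reflects = run-reflects n (λ x → x) start arrive

module Model (m : ℕ) (p : ℚ) where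

  open Expectation (sumVertexData (suc m)) (sumVertexData-cong (suc m)) (sumVertexData-*ˡ (suc m)) public
  open Exploration (suc m)

  -- The summand of Pr is local to Defs and cannot be named.  Unfolded two levels it is applied
  -- to variables only, so the four summand equations below leave their left-hand side to
  -- unification, which is why they are stated with _ and follow Pr≡𝔼𝟙 in a mutual block.
  private
    Rest : Set
    Rest = Fin m → VertexData (suc m)

    ∑Rest : (Rest → ℚ) → ℚ
    ∑Rest = sumFuns (sumVertexData (suc m)) m

  sumFuns-cong-unfolded : ∀ {F₀ᵗ F₀ᶠ : Rest → ℚ} {Fₛᵗ Fₛᶠ : Fin m → Rest → ℚ} (G : Outcome (suc m) → ℚ) →
    (∀ g → F₀ᵗ g ≡ G ((zero , true) ∷ g)) → (∀ g → F₀ᶠ g ≡ G ((zero , false) ∷ g)) →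
    (∀ i g → Fₛᵗ i g ≡ G ((suc i , true) ∷ g)) → (∀ i g → Fₛᶠ i g ≡ G ((suc i , false) ∷ g)) →
    (∑Rest F₀ᵗ + ∑Rest F₀ᶠ) + sumFin m (λ i → ∑Rest (Fₛᵗ i) + ∑Rest (Fₛᶠ i))
    ≡ sumFuns (sumVertexData (suc m)) (suc m) G
  sumFuns-cong-unfolded G eq₀ᵗ eq₀ᶠ eqₛᵗ eqₛᶠ =
    cong₂ _+_ (cong₂ _+_ (sumFuns-cong m eq₀ᵗ) (sumFuns-cong m eq₀ᶠ))
              (sumFin-cong (λ i → cong₂ _+_ (sumFuns-cong m (eqₛᵗ i)) (sumFuns-cong m (eqₛᶠ i))))
    where
    sumFin-cong : ∀ {f g : Fin m → ℚ} → (∀ i → f i ≡ g i) → sumFin m f ≡ sumFin m g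
    sumFin-cong {f} {g} f≗g = trans (sumFin≡∑ m f) (trans (sum-cong-≗ f≗g) (sym (sumFin≡∑ m g)))

  module _ {E : Outcome (suc m) → Set} (E? : Decidable E) where

    private
      𝟙E : Outcome (suc m) → ℚ
      𝟙E o = 𝟙 (does (E? o)) * outcomeWeight m p o

      yes-weight : ∀ o → outcomeWeight m p o ≡ 𝟙 true * outcomeWeight m p o
      yes-weight o = sym (*-identityˡ (outcomeWeight m p o))

      no-weight : ∀ o → 0ℚ ≡ 𝟙 false * outcomeWeight m p o
      no-weight o = sym (*-zeroˡ (outcomeWeight m p o))

    mutual
      Pr≡𝔼𝟙 : Pr m p E? ≡ 𝔼 (vertexWeight m p) (suc m) (λ o → 𝟙 (does (E? o)))
      Pr≡𝔼𝟙 = sumFuns-cong-unfolded 𝟙E at₀ᵗ at₀ᶠ atₛᵗ atₛᶠ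

      at₀ᵗ : ∀ g → _ ≡ 𝟙E ((zero , true) ∷ g)
      at₀ᵗ g with E? ((zero , true) ∷ g)
      ... | yes _ = yes-weight ((zero , true) ∷ g)
      ... | no _  = no-weight ((zero , true) ∷ g)

      at₀ᶠ : ∀ g → _ ≡ 𝟙E ((zero , false) ∷ g)
      at₀ᶠ g with E? ((zero , false) ∷ g)
      ... | yes _ = yes-weight ((zero , false) ∷ g)
      ... | no _  = no-weight ((zero , false) ∷ g)

      atₛᵗ : ∀ i g → _ ≡ 𝟙E ((suc i , true) ∷ g)
      atₛᵗ i g with E? ((suc i , true) ∷ g)
      ... | yes _ = yes-weight ((suc i , true) ∷ g)
      ... | no _  = no-weight ((suc i , true) ∷ g)

      atₛᶠ : ∀ i g → _ ≡ 𝟙E ((suc i , false) ∷ g)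
      atₛᶠ i g with E? ((suc i , false) ∷ g)
      ... | yes _ = yes-weight ((suc i , false) ∷ g)
      ... | no _  = no-weight ((suc i , false) ∷ g)

  1/n : ℚ
  1/n = + 1 / suc m

  avg : (Fin (suc m) → ℚ) → ℚ
  avg f = 1/n * ∑[ x < suc m ] f x

  avg-cong : ∀ {f g} → (∀ x → f x ≡ g x) → avg f ≡ avg g
  avg-cong f≗g = cong (1/n *_) (sum-cong-≗ f≗g)

  avg-const : ∀ c → avg (λ _ → c) ≡ c
  avg-const c = begin
    1/n * ∑[ x < suc m ] c        ≡⟨ cong (1/n *_) (∑-const (suc m) c) ⟩
    1/n * (fromℤ (+ suc m) * c)   ≡⟨ *-assoc 1/n _ c ⟨
    1/n * fromℤ (+ suc m) * c     ≡⟨ cong (_* c) (1/n*n≡1 m) ⟩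
    1ℚ * c                        ≡⟨ *-identityˡ c ⟩
    c                             ∎

  avg-+ : ∀ f g → avg (λ x → f x + g x) ≡ avg f + avg g
  avg-+ f g = trans (cong (1/n *_) (∑-distrib-+ f g)) (*-distribˡ-+ 1/n _ _)

  avg-*ʳ : ∀ f c → avg (λ x → f x * c) ≡ avg f * c
  avg-*ʳ f c = trans (cong (1/n *_) (sym (*-distribʳ-sum c f))) (sym (*-assoc 1/n (∑[ x < suc m ] f x) c))

  avg-affine : ∀ c f d g e → avg (λ x → c + f x * d + g x * e) ≡ c + avg f * d + avg g * e
  avg-affine c f d g e = begin
    avg (λ x → c + f x * d + g x * e)
      ≡⟨ avg-+ (λ x → c + f x * d) (λ x → g x * e) ⟩
    avg (λ x → c + f x * d) + avg (λ x → g x * e)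
      ≡⟨ cong₂ _+_ (avg-+ (λ _ → c) (λ x → f x * d)) (avg-*ʳ g e) ⟩
    avg (λ _ → c) + avg (λ x → f x * d) + avg g * e
      ≡⟨ cong₂ (λ u v → u + v + avg g * e) (avg-const c) (avg-*ʳ f d) ⟩
    c + avg f * d + avg g * e
      ∎

  vertex-expectation : ∀ (f : VertexData (suc m) → ℚ) →
                       sumVertexData (suc m) (λ a → vertexWeight m p a * f a)
                       ≡ avg (λ w → p * f (w , true) + (1ℚ - p) * f (w , false))
  vertex-expectation f = begin
    sumVertexData (suc m) (λ a → vertexWeight m p a * f a)
      ≡⟨ sumVertexData≡∑ (suc m) (λ a → vertexWeight m p a * f a) ⟩
    ∑[ w < suc m ] (1/n * p * f (w , true) + 1/n * (1ℚ - p) * f (w , false))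
      ≡⟨ sum-cong-≗ (λ w → factor 1/n p (f (w , true)) (f (w , false))) ⟩
    ∑[ w < suc m ] (1/n * (p * f (w , true) + (1ℚ - p) * f (w , false)))
      ≡⟨ *-distribˡ-sum 1/n (λ w → p * f (w , true) + (1ℚ - p) * f (w , false)) ⟨
    avg (λ w → p * f (w , true) + (1ℚ - p) * f (w , false))
      ∎
    where
    factor : ∀ d p a b → d * p * a + d * (1ℚ - p) * b ≡ d * (p * a + (1ℚ - p) * b)
    factor = solve-∀ ℚ-ring

  alive : ∀ {k} → (Fin (suc m) → Maybe (Fin k)) → ℚ
  alive φ = avg (λ x → 𝟙 (is-just (φ x)))

  value : ∀ k → State k → ℚ
  value k cycle         = 1ℚ
  value k (exploring φ) = p * alive φ

  module _ {k} (φ : Fin (suc m) → Maybe (Fin (suc k))) where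

    private
      a₁ a₂ : ℚ
      a₁ = avg (λ x → toCurrent (φ x))
      a₂ = avg (λ x → toLater (φ x))

    alive-split : alive φ ≡ a₁ + a₂
    alive-split = trans (avg-cong (λ x → 𝟙-is-just-split (φ x)))
                        (avg-+ (λ x → toCurrent (φ x)) (λ x → toLater (φ x)))

    value-settle-nothing : value k (settle φ nothing) ≡ p * a₂
    value-settle-nothing = cong (p *_) (avg-cong (λ x → 𝟙-is-just-retarget-nothing (φ x)))

    value-settle : ∀ r → value k (settle φ r) ≡ p * a₂ + toCurrent r * (1ℚ - p * a₂) + toLater r * (p * a₁)
    value-settle nothing        = trans value-settle-nothing (at-nothing (p * a₂) (1ℚ - p * a₂) (p * a₁))
      where
      at-nothing : ∀ x y z → x ≡ x + 0ℚ * y + 0ℚ * z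
      at-nothing = solve-∀ ℚ-ring
    value-settle (just zero)    = at-current (p * a₂) (p * a₁)
      where
      at-current : ∀ x z → 1ℚ ≡ x + 1ℚ * (1ℚ - x) + 0ℚ * z
      at-current = solve-∀ ℚ-ring
    value-settle (just (suc j)) = begin
      p * alive (λ x → retarget (just j) (φ x))
        ≡⟨ cong (p *_) (avg-cong (λ x → 𝟙-is-just-retarget-just j (φ x))) ⟩
      p * alive φ
        ≡⟨ cong (p *_) alive-split ⟩
      p * (a₁ + a₂)
        ≡⟨ at-later p a₁ a₂ ⟩
      p * a₂ + 0ℚ * (1ℚ - p * a₂) + 1ℚ * (p * a₁)
        ∎
      where
      at-later : ∀ p a b → p * (a + b) ≡ p * b + 0ℚ * (1ℚ - p * b) + 1ℚ * (p * a)
      at-later = solve-∀ ℚ-ring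

    value-visit-exploring : sumVertexData (suc m) (λ a → vertexWeight m p a * value k (visit k (exploring φ) a))
                            ≡ value (suc k) (exploring φ)
    value-visit-exploring = begin
      sumVertexData (suc m) (λ a → vertexWeight m p a * value k (visit k (exploring φ) a))
        ≡⟨ vertex-expectation (λ a → value k (visit k (exploring φ) a)) ⟩
      avg (λ w → p * value k (settle φ (φ w)) + (1ℚ - p) * value k (settle φ nothing))
        ≡⟨ avg-cong (λ w → cong₂ (λ u v → p * u + (1ℚ - p) * v)
                                 (value-settle (φ w)) value-settle-nothing) ⟩
      avg (λ w → p * (p * a₂ + toCurrent (φ w) * (1ℚ - p * a₂) + toLater (φ w) * (p * a₁))
                 + (1ℚ - p) * (p * a₂))
        ≡⟨ avg-cong (λ w → regroup p a₁ a₂ (toCurrent (φ w)) (toLater (φ w))) ⟩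
      avg (λ w → p * a₂ + toCurrent (φ w) * (p * (1ℚ - p * a₂)) + toLater (φ w) * (p * (p * a₁)))
        ≡⟨ avg-affine (p * a₂) (λ w → toCurrent (φ w)) (p * (1ℚ - p * a₂))
                              (λ w → toLater (φ w)) (p * (p * a₁)) ⟩
      p * a₂ + a₁ * (p * (1ℚ - p * a₂)) + a₂ * (p * (p * a₁))
        ≡⟨ collapse p a₁ a₂ ⟩
      p * (a₁ + a₂)
        ≡⟨ cong (p *_) alive-split ⟨
      p * alive φ
        ∎
      where
      regroup : ∀ p a b u v → p * (p * b + u * (1ℚ - p * b) + v * (p * a)) + (1ℚ - p) * (p * b)
                              ≡ p * b + u * (p * (1ℚ - p * b)) + v * (p * (p * a))
      regroup = solve-∀ ℚ-ring
      collapse : ∀ p a b → p * b + a * (p * (1ℚ - p * b)) + b * (p * (p * a)) ≡ p * (a + b)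
      collapse = solve-∀ ℚ-ring

  value-visit : ∀ k (s : State (suc k)) →
                sumVertexData (suc m) (λ a → vertexWeight m p a * value k (visit k s a)) ≡ value (suc k) s
  value-visit k cycle         = begin
    sumVertexData (suc m) (λ a → vertexWeight m p a * 1ℚ)  ≡⟨ vertex-expectation (λ _ → 1ℚ) ⟩
    avg (λ _ → p * 1ℚ + (1ℚ - p) * 1ℚ)                     ≡⟨ avg-cong (λ _ → total p) ⟩
    avg (λ _ → 1ℚ)                                         ≡⟨ avg-const 1ℚ ⟩
    1ℚ                                                     ∎
    where
    total : ∀ p → p * 1ℚ + (1ℚ - p) * 1ℚ ≡ 1ℚ
    total = solve-∀ ℚ-ring
  value-visit k (exploring φ) = value-visit-exploring φ

  value-start : value (suc m) start ≡ p
  value-start = trans (cong (p *_) (avg-const 1ℚ)) (*-identityʳ p)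

  value-final : (s : State 0) → value 0 s ≡ 𝟙 (isCycle s)
  value-final cycle         = refl
  value-final (exploring φ) = begin
    p * avg (λ x → 𝟙 (is-just (φ x)))  ≡⟨ cong (p *_) (avg-cong (λ x → nowhere (φ x))) ⟩
    p * avg (λ _ → 0ℚ)                 ≡⟨ cong (p *_) (avg-const 0ℚ) ⟩
    p * 0ℚ                             ≡⟨ *-zeroʳ p ⟩
    0ℚ                                 ∎
    where
    nowhere : (r : Maybe (Fin 0)) → 𝟙 (is-just r) ≡ 0ℚ
    nowhere nothing = refl

lemma1 : (m : ℕ) (p : ℚ) → 0ℚ ≤ p → p ≤ 1ℚ →
         (cyc? : Decidable (HasCycle {suc m})) →
         Pr m p cyc? ≡ p
lemma1 m p _ _ cyc? = begin
  Pr m p cyc?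
    ≡⟨ Pr≡𝔼𝟙 cyc? ⟩
  𝔼 (vertexWeight m p) (suc m) (λ o → 𝟙 (does (cyc? o)))
    ≡⟨ 𝔼-cong (vertexWeight m p) (suc m) cycle-indicator ⟩
  𝔼 (vertexWeight m p) (suc m) (λ o → value 0 (run visit (suc m) start o))
    ≡⟨ 𝔼-value-run (vertexWeight m p) visit value value-visit (suc m) start ⟩
  value (suc m) start
    ≡⟨ value-start ⟩
  p ∎
  where
  open Exploration (suc m)
  open Model m p
  cycle-indicator : ∀ o → 𝟙 (does (cyc? o)) ≡ value 0 (run visit (suc m) start o)
  cycle-indicator o = trans (cong 𝟙 (det (proof (cyc? o)) (start-reflects o)))
                            (sym (value-final (run visit (suc m) start o)))
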